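{- For every integer $n\ge 1$, the $3\times 3\times n$ box admits no tiling by $1\times 2\times 2$ bricks.
   Context: A tiling of a $k\times m\times n$ box (made of $kmn$ unit cubes) by $t_1\times t_2\times t_3$ bricks is a set of non-overlapping axis-parallel boxes with integer corners, each congruent to the brick (i.e. of dimensions some permutation of $(t_1,t_2,t_3)$; all orientations may be mixed), whose union is the box. -}

module Defs where

open import Data.Nat using (ℕ; _+_; _≤_; _<_)
open import Data.Fin using (Fin)
open import Data.Product using (Σ; ∃; _×_; _,_)
open import Data.Sum using (_⊎_)
open import Relation.Binary.PropositionalEquality using (_≡_)

-- A unit cell is identified with its minimal corner (i , j , l) ∈ ℕ³;
-- it occupies [i,i+1] × [j,j+1] × [l,l+1].
Cell : Set
Cell = ℕ × ℕ × ℕ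

-- An axis-parallel box with integer corners: minimal corner (x , y , z)
-- and side lengths (a , b , c).
record Box : Set where
  constructor box
  field
    x y z : ℕ
    a b c : ℕ
open Box public

_∈Box_ : Cell → Box → Set
(i , j , l) ∈Box B =
  (x B ≤ i × i < x B + a B) ×
  (y B ≤ j × j < y B + b B) ×
  (z B ≤ l × l < z B + c B)

IsPerm3 : ℕ × ℕ × ℕ → ℕ × ℕ × ℕ → Set
IsPerm3 (a , b , c) (t₁ , t₂ , t₃) =
    (a ≡ t₁ × b ≡ t₂ × c ≡ t₃)
  ⊎ (a ≡ t₁ × b ≡ t₃ × c ≡ t₂)
  ⊎ (a ≡ t₂ × b ≡ t₁ × c ≡ t₃)
  ⊎ (a ≡ t₂ × b ≡ t₃ × c ≡ t₁)
  ⊎ (a ≡ t₃ × b ≡ t₁ × c ≡ t₂)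
  ⊎ (a ≡ t₃ × b ≡ t₂ × c ≡ t₁)

CongruentTo : Box → ℕ × ℕ × ℕ → Set
CongruentTo B t = IsPerm3 (a B , b B , c B) t

Region : ℕ → ℕ → ℕ → Box
Region k m n = box 0 0 0 k m n

record Tiling (k m n : ℕ) (t : ℕ × ℕ × ℕ) : Set where
  field
    N      : ℕ
    brick  : Fin N → Box
    shape  : ∀ p → CongruentTo (brick p) t
    inside : ∀ p (v : Cell) → v ∈Box brick p → v ∈Box Region k m n
    disjoint : ∀ p q (v : Cell) → v ∈Box brick p → v ∈Box brick q → p ≡ q
    cover  : ∀ (v : Cell) → v ∈Box Region k m n → ∃ λ p → v ∈Box brick p

-- Colour the cell (i , j , l) black when i + j is even and white otherwise.
-- Every orientation of a 1 × 2 × 2 brick has a side of length 2 along the first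
-- or second axis, so every brick covers as many black as white cells; but each
-- 3 × 3 layer of the box has five black and four white cells, so a tiling of
-- the 3 × 3 × n box would give 5n = 4n.
module Submission where

open import Defs
open import Data.Nat using (ℕ; zero; suc; s≤s⁻¹; _+_; _*_; _∸_; _%_; _≤_; _<_; z≤n; s≤s; _≤?_; _<?_)
open import Data.Nat.Properties
  using (+-*-semiring; +-comm; +-suc; +-identityʳ; *-identityˡ; m≤m+n; ≤-trans; ≤-reflexive; *-cancelˡ-≡)
open import Data.Nat.Solver using (module +-*-Solver)
open import Data.Fin using (Fin; toℕ; punchIn)
open import Data.Fin.Properties using (toℕ<n; punchInᵢ≢i)
open import Data.Vec.Functional using (Vector)
open import Data.Product using (_,_; _×_)
open import Data.Sum using (inj₁; inj₂)
open import Relation.Nullary using (¬_; Dec; yes; no; contradiction)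
open import Relation.Nullary.Decidable using (_×-dec_)
open import Relation.Binary.PropositionalEquality
  using (_≡_; _≢_; refl; sym; trans; cong; subst; module ≡-Reasoning)
open import Algebra.Properties.Semiring.Sum +-*-semiring
  using (sum; sum-syntax; sum-cong-≗; sum-remove; sum-replicate-zero; ∑-comm; *-distribˡ-sum; *-distribʳ-sum)

open ≡-Reasoning

𝟙 : ∀ {p} {P : Set p} → Dec P → ℕ
𝟙 (yes _) = 1
𝟙 (no _)  = 0

𝟙-yes : ∀ {p} {P : Set p} (d : Dec P) → P → 𝟙 d ≡ 1
𝟙-yes (yes _) _ = refl
𝟙-yes (no ¬p) p = contradiction p ¬p

𝟙-no : ∀ {p} {P : Set p} (d : Dec P) → ¬ P → 𝟙 d ≡ 0
𝟙-no (yes p) ¬p = contradiction p ¬p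
𝟙-no (no _)  _  = refl

𝟙-×-dec : ∀ {p q} {P : Set p} {Q : Set q} (d : Dec P) (e : Dec Q) → 𝟙 (d ×-dec e) ≡ 𝟙 d * 𝟙 e
𝟙-×-dec (yes _) (yes _) = refl
𝟙-×-dec (yes _) (no _)  = refl
𝟙-×-dec (no _)  _       = refl

𝟙-cong : ∀ {p q} {P : Set p} {Q : Set q} (d : Dec P) (e : Dec Q) → (P → Q) → (Q → P) → 𝟙 d ≡ 𝟙 e
𝟙-cong (yes _) (yes _) _   _   = refl
𝟙-cong (yes p) (no ¬q) P→Q _   = contradiction (P→Q p) ¬q
𝟙-cong (no ¬p) (yes q) _   Q→P = contradiction (Q→P q) ¬p
𝟙-cong (no _)  (no _)  _   _   = refl

∑-const : ∀ n c → ∑[ i < n ] c ≡ n * c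
∑-const zero    c = refl
∑-const (suc n) c = cong (c +_) (∑-const n c)

sum-single-support : ∀ {N} (f : Vector ℕ N) q → (∀ p → p ≢ q → f p ≡ 0) → sum f ≡ f q
sum-single-support {suc N} f q off = begin
  sum f                             ≡⟨ sum-remove {i = q} f ⟩
  f q + ∑[ p < N ] f (punchIn q p)  ≡⟨ cong (f q +_) (sum-cong-≗ (λ p → off _ (punchInᵢ≢i q p))) ⟩
  f q + ∑[ p < N ] 0                ≡⟨ cong (f q +_) (sum-replicate-zero N) ⟩
  f q + 0                           ≡⟨ +-identityʳ (f q) ⟩
  f q                               ∎

within? : ∀ x a i → Dec (x ≤ i × i < x + a)
within? x a i = (x ≤? i) ×-dec (i <? x + a)

within?-suc : ∀ x a i → 𝟙 (within? (suc x) a (suc i)) ≡ 𝟙 (within? x a i)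
within?-suc x a i = 𝟙-cong (within? (suc x) a (suc i)) (within? x a i)
  (λ (x≤i , i<x+a) → s≤s⁻¹ x≤i , s≤s⁻¹ i<x+a)
  (λ (x≤i , i<x+a) → s≤s x≤i , s≤s i<x+a)

within?-zero-suc : ∀ a i → 𝟙 (within? 0 (suc a) (suc i)) ≡ 𝟙 (within? 0 a i)
within?-zero-suc a i = 𝟙-cong (within? 0 (suc a) (suc i)) (within? 0 a i)
  (λ (_ , i<a) → z≤n , s≤s⁻¹ i<a)
  (λ (_ , i<a) → z≤n , s≤s i<a)

∑-within : ∀ n x a → x + a ≤ n → ∑[ i < n ] 𝟙 (within? x a (toℕ i)) ≡ a
∑-within zero    zero    zero    _           = refl
∑-within (suc n) (suc x) a       (s≤s x+a≤n) =
  trans (sum-cong-≗ {n} (λ i → within?-suc x a (toℕ i))) (∑-within n x a x+a≤n)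
∑-within (suc n) zero    (suc a) (s≤s a≤n)   =
  cong suc (trans (sum-cong-≗ {n} (λ i → within?-zero-suc a (toℕ i))) (∑-within n zero a a≤n))
∑-within (suc n) zero    zero    _           = ∑-within n zero zero z≤n

_∈Box?_ : ∀ v B → Dec (v ∈Box B)
(i , j , l) ∈Box? B = within? (x B) (a B) i ×-dec within? (y B) (b B) j ×-dec within? (z B) (c B) l

∑Region : ℕ → ℕ → ℕ → (Cell → ℕ) → ℕ
∑Region k m n ω = ∑[ i < k ] ∑[ j < m ] ∑[ l < n ] ω (toℕ i , toℕ j , toℕ l)

∑Region-cong : ∀ k m n {ω ω′ : Cell → ℕ} →
  (∀ v → v ∈Box Region k m n → ω v ≡ ω′ v) → ∑Region k m n ω ≡ ∑Region k m n ω′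
∑Region-cong k m n eq = sum-cong-≗ {k} λ i → sum-cong-≗ {m} λ j → sum-cong-≗ {n} λ l →
  eq _ ((z≤n , toℕ<n i) , (z≤n , toℕ<n j) , (z≤n , toℕ<n l))

∑Region-∑ : ∀ k m n {N} (F : Fin N → Cell → ℕ) →
  ∑Region k m n (λ v → ∑[ p < N ] F p v) ≡ ∑[ p < N ] ∑Region k m n (F p)
∑Region-∑ k m n {N} F = begin
  ∑[ i < k ] ∑[ j < m ] ∑[ l < n ] ∑[ p < N ] F p (cell i j l)
    ≡⟨ sum-cong-≗ {k} (λ i → sum-cong-≗ {m} λ j → ∑-comm (λ l p → F p (cell i j l))) ⟩
  ∑[ i < k ] ∑[ j < m ] ∑[ p < N ] ∑[ l < n ] F p (cell i j l)
    ≡⟨ sum-cong-≗ {k} (λ i → ∑-comm (λ j p → ∑[ l < n ] F p (cell i j l))) ⟩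
  ∑[ i < k ] ∑[ p < N ] ∑[ j < m ] ∑[ l < n ] F p (cell i j l)
    ≡⟨ ∑-comm (λ i p → ∑[ j < m ] ∑[ l < n ] F p (cell i j l)) ⟩
  ∑[ p < N ] ∑Region k m n (F p) ∎
  where
  cell : Fin k → Fin m → Fin n → Cell
  cell i j l = toℕ i , toℕ j , toℕ l

boxWeight : ℕ → ℕ → ℕ → (Cell → ℕ) → Box → ℕ
boxWeight k m n ω B = ∑Region k m n (λ v → 𝟙 (v ∈Box? B) * ω v)

module _ {k m n t} (T : Tiling k m n t) where
  open Tiling T

  ∑-𝟙-bricks : ∀ v → v ∈Box Region k m n → ∑[ p < N ] 𝟙 (v ∈Box? brick p) ≡ 1
  ∑-𝟙-bricks v v∈R with cover v v∈R
  ... | q , v∈q = trans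
    (sum-single-support _ q (λ p p≢q → 𝟙-no (v ∈Box? brick p) (λ v∈p → p≢q (disjoint p q v v∈p v∈q))))
    (𝟙-yes (v ∈Box? brick q) v∈q)

  ∑Region-bricks : ∀ ω → ∑Region k m n ω ≡ ∑[ p < N ] boxWeight k m n ω (brick p)
  ∑Region-bricks ω = begin
    ∑Region k m n ω
      ≡⟨ ∑Region-cong k m n (λ v v∈R → sym (trans (cong (_* ω v) (∑-𝟙-bricks v v∈R)) (*-identityˡ (ω v)))) ⟩
    ∑Region k m n (λ v → (∑[ p < N ] 𝟙 (v ∈Box? brick p)) * ω v)
      ≡⟨ ∑Region-cong k m n (λ v _ → *-distribʳ-sum {N} (ω v) (λ p → 𝟙 (v ∈Box? brick p))) ⟩
    ∑Region k m n (λ v → ∑[ p < N ] (𝟙 (v ∈Box? brick p) * ω v))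
      ≡⟨ ∑Region-∑ k m n (λ p v → 𝟙 (v ∈Box? brick p) * ω v) ⟩
    ∑[ p < N ] boxWeight k m n ω (brick p) ∎

  ∑Region-tiling-invariant : ∀ ω ω′ → (∀ p → boxWeight k m n ω (brick p) ≡ boxWeight k m n ω′ (brick p)) →
    ∑Region k m n ω ≡ ∑Region k m n ω′
  ∑Region-tiling-invariant ω ω′ eq = begin
    ∑Region k m n ω                         ≡⟨ ∑Region-bricks ω ⟩
    ∑[ p < N ] boxWeight k m n ω (brick p)  ≡⟨ sum-cong-≗ {N} eq ⟩
    ∑[ p < N ] boxWeight k m n ω′ (brick p) ≡⟨ sym (∑Region-bricks ω′) ⟩
    ∑Region k m n ω′                        ∎

onSection : (ℕ → ℕ → ℕ) → Cell → ℕ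
onSection h (i , j , _) = h i j

∑Region-onSection : ∀ k m n h →
  ∑Region k m n (onSection h) ≡ n * ∑[ i < k ] ∑[ j < m ] h (toℕ i) (toℕ j)
∑Region-onSection k m n h = begin
  ∑[ i < k ] ∑[ j < m ] ∑[ l < n ] h (toℕ i) (toℕ j)
    ≡⟨ sum-cong-≗ {k} (λ i → sum-cong-≗ {m} λ j → ∑-const n (h (toℕ i) (toℕ j))) ⟩
  ∑[ i < k ] ∑[ j < m ] (n * h (toℕ i) (toℕ j))
    ≡⟨ sum-cong-≗ {k} (λ i → sym (*-distribˡ-sum {m} n (λ j → h (toℕ i) (toℕ j)))) ⟩
  ∑[ i < k ] (n * ∑[ j < m ] h (toℕ i) (toℕ j))
    ≡⟨ sym (*-distribˡ-sum {k} n (λ i → ∑[ j < m ] h (toℕ i) (toℕ j))) ⟩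
  n * ∑[ i < k ] ∑[ j < m ] h (toℕ i) (toℕ j) ∎

rectWeight : ℕ → ℕ → (ℕ → ℕ → ℕ) → ℕ → ℕ → ℕ → ℕ → ℕ
rectWeight k m h x a y b =
  ∑[ i < k ] ∑[ j < m ] (𝟙 (within? x a (toℕ i)) * 𝟙 (within? y b (toℕ j)) * h (toℕ i) (toℕ j))

boxWeight-onSection : ∀ k m n h B → z B + c B ≤ n →
  boxWeight k m n (onSection h) B ≡ rectWeight k m h (x B) (a B) (y B) (b B) * c B
boxWeight-onSection k m n h (box x y z a b c) z+c≤n = begin
  ∑[ i < k ] ∑[ j < m ] ∑[ l < n ] (𝟙 ((toℕ i , toℕ j , toℕ l) ∈Box? B) * h (toℕ i) (toℕ j))
    ≡⟨ sum-cong-≗ {k} (λ i → sum-cong-≗ {m} λ j → sum-cong-≗ {n} λ l → split (toℕ i) (toℕ j) (toℕ l)) ⟩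
  ∑[ i < k ] ∑[ j < m ] ∑[ l < n ] (X (toℕ i) (toℕ j) * Iz (toℕ l))
    ≡⟨ sum-cong-≗ {k} (λ i → sum-cong-≗ {m} λ j → sym (*-distribˡ-sum {n} (X (toℕ i) (toℕ j)) (λ l → Iz (toℕ l)))) ⟩
  ∑[ i < k ] ∑[ j < m ] (X (toℕ i) (toℕ j) * ∑[ l < n ] Iz (toℕ l))
    ≡⟨ sum-cong-≗ {k} (λ i → sum-cong-≗ {m} λ j → cong (X (toℕ i) (toℕ j) *_) (∑-within n z c z+c≤n)) ⟩
  ∑[ i < k ] ∑[ j < m ] (X (toℕ i) (toℕ j) * c)
    ≡⟨ sum-cong-≗ {k} (λ i → sym (*-distribʳ-sum {m} c (λ j → X (toℕ i) (toℕ j)))) ⟩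
  ∑[ i < k ] (∑[ j < m ] X (toℕ i) (toℕ j) * c)
    ≡⟨ sym (*-distribʳ-sum {k} c (λ i → ∑[ j < m ] X (toℕ i) (toℕ j))) ⟩
  rectWeight k m h x a y b * c ∎
  where
  open +-*-Solver
  B = box x y z a b c
  Iz : ℕ → ℕ
  Iz l = 𝟙 (within? z c l)
  X : ℕ → ℕ → ℕ
  X i j = 𝟙 (within? x a i) * 𝟙 (within? y b j) * h i j
  split : ∀ i j l → 𝟙 ((i , j , l) ∈Box? B) * h i j ≡ X i j * Iz l
  split i j l = begin
    𝟙 ((i , j , l) ∈Box? B) * h i j
      ≡⟨ cong (_* h i j) (trans (𝟙-×-dec (within? x a i) _) (cong (𝟙 (within? x a i) *_) (𝟙-×-dec (within? y b j) _))) ⟩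
    𝟙 (within? x a i) * (𝟙 (within? y b j) * Iz l) * h i j
      ≡⟨ solve 4 (λ p q r s → p :* (q :* r) :* s := p :* q :* s :* r) refl
           (𝟙 (within? x a i)) (𝟙 (within? y b j)) (Iz l) (h i j) ⟩
    X i j * Iz l ∎

last-∈-interval : ∀ x a → x ≤ x + a × x + a < x + suc a
last-∈-interval x a = m≤m+n x a , ≤-reflexive (sym (+-suc x a))

inside-bounds : ∀ {k m n} B → 0 < a B → 0 < b B → 0 < c B →
  (∀ v → v ∈Box B → v ∈Box Region k m n) → x B + a B ≤ k × y B + b B ≤ m × z B + c B ≤ n
inside-bounds (box x y z (suc a) (suc b) (suc c)) _ _ _ inside
  with (_ , x+a<k) , (_ , y+b<m) , (_ , z+c<n) ← inside (x + a , y + b , z + c) (last-∈-interval x a , last-∈-interval y b , last-∈-interval z c)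
  = ≤-trans (≤-reflexive (+-suc x a)) x+a<k
  , ≤-trans (≤-reflexive (+-suc y b)) y+b<m
  , ≤-trans (≤-reflexive (+-suc z c)) z+c<n

CongruentTo-positive : ∀ {t₁ t₂ t₃} B → 0 < t₁ → 0 < t₂ → 0 < t₃ →
  CongruentTo B (t₁ , t₂ , t₃) → 0 < a B × 0 < b B × 0 < c B
CongruentTo-positive _ p q r (inj₁ (refl , refl , refl))                               = p , q , r
CongruentTo-positive _ p q r (inj₂ (inj₁ (refl , refl , refl)))                        = p , r , q
CongruentTo-positive _ p q r (inj₂ (inj₂ (inj₁ (refl , refl , refl))))                 = q , p , r
CongruentTo-positive _ p q r (inj₂ (inj₂ (inj₂ (inj₁ (refl , refl , refl)))))          = q , r , p
CongruentTo-positive _ p q r (inj₂ (inj₂ (inj₂ (inj₂ (inj₁ (refl , refl , refl))))))   = r , p , q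
CongruentTo-positive _ p q r (inj₂ (inj₂ (inj₂ (inj₂ (inj₂ (refl , refl , refl))))))   = r , q , p

data Footprint : ℕ → ℕ → Set where
  1×2 : Footprint 1 2
  2×1 : Footprint 2 1
  2×2 : Footprint 2 2

footprint-122 : ∀ B → CongruentTo B (1 , 2 , 2) → Footprint (a B) (b B)
footprint-122 _ (inj₁ (refl , refl , refl))                             = 1×2
footprint-122 _ (inj₂ (inj₁ (refl , refl , refl)))                      = 1×2
footprint-122 _ (inj₂ (inj₂ (inj₁ (refl , refl , refl))))               = 2×1
footprint-122 _ (inj₂ (inj₂ (inj₂ (inj₁ (refl , refl , refl)))))        = 2×2
footprint-122 _ (inj₂ (inj₂ (inj₂ (inj₂ (inj₁ (refl , refl , refl)))))) = 2×1
footprint-122 _ (inj₂ (inj₂ (inj₂ (inj₂ (inj₂ (refl , refl , refl)))))) = 2×2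

white black : ℕ → ℕ → ℕ
white i j = (i + j) % 2
black i j = 1 ∸ white i j

-- The bounds are written a + x, b + y so that the impossible positions are refuted by computation.
rect-balanced : ∀ {a b} x y → Footprint a b → a + x ≤ 3 → b + y ≤ 3 →
  rectWeight 3 3 black x a y b ≡ rectWeight 3 3 white x a y b
rect-balanced 0 0 1×2 _ _ = refl
rect-balanced 0 1 1×2 _ _ = refl
rect-balanced 1 0 1×2 _ _ = refl
rect-balanced 1 1 1×2 _ _ = refl
rect-balanced 2 0 1×2 _ _ = refl
rect-balanced 2 1 1×2 _ _ = refl
rect-balanced 0 0 2×1 _ _ = refl
rect-balanced 0 1 2×1 _ _ = refl
rect-balanced 0 2 2×1 _ _ = refl
rect-balanced 1 0 2×1 _ _ = refl
rect-balanced 1 1 2×1 _ _ = refl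
rect-balanced 1 2 2×1 _ _ = refl
rect-balanced 0 0 2×2 _ _ = refl
rect-balanced 0 1 2×2 _ _ = refl
rect-balanced 1 0 2×2 _ _ = refl
rect-balanced 1 1 2×2 _ _ = refl
rect-balanced (suc (suc (suc _))) _ 1×2 (s≤s (s≤s (s≤s ()))) _
rect-balanced _ (suc (suc _)) 1×2 _ (s≤s (s≤s (s≤s ())))
rect-balanced (suc (suc _)) _ 2×1 (s≤s (s≤s (s≤s ()))) _
rect-balanced _ (suc (suc (suc _))) 2×1 _ (s≤s (s≤s (s≤s ())))
rect-balanced (suc (suc _)) _ 2×2 (s≤s (s≤s (s≤s ()))) _
rect-balanced _ (suc (suc _)) 2×2 _ (s≤s (s≤s (s≤s ())))

brick-balanced : ∀ n B → CongruentTo B (1 , 2 , 2) → (∀ v → v ∈Box B → v ∈Box Region 3 3 n) →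
  boxWeight 3 3 n (onSection black) B ≡ boxWeight 3 3 n (onSection white) B
brick-balanced n B shape inside =
  let 0<a , 0<b , 0<c = CongruentTo-positive B (s≤s z≤n) (s≤s z≤n) (s≤s z≤n) shape
      x+a≤3 , y+b≤3 , z+c≤n = inside-bounds B 0<a 0<b 0<c inside
  in begin
  boxWeight 3 3 n (onSection black) B
    ≡⟨ boxWeight-onSection 3 3 n black B z+c≤n ⟩
  rectWeight 3 3 black (x B) (a B) (y B) (b B) * c B
    ≡⟨ cong (_* c B) (rect-balanced (x B) (y B) (footprint-122 B shape)
         (subst (_≤ 3) (+-comm (x B) (a B)) x+a≤3) (subst (_≤ 3) (+-comm (y B) (b B)) y+b≤3)) ⟩
  rectWeight 3 3 white (x B) (a B) (y B) (b B) * c B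
    ≡⟨ sym (boxWeight-onSection 3 3 n white B z+c≤n) ⟩
  boxWeight 3 3 n (onSection white) B ∎

mainTheorem15 : ∀ (n : ℕ) → 1 ≤ n → ¬ Tiling 3 3 n (1 , 2 , 2)
mainTheorem15 n@(suc _) _ T = contradiction (*-cancelˡ-≡ 5 4 n n*5≡n*4) λ ()
  where
  open Tiling T
  n*5≡n*4 : n * 5 ≡ n * 4
  n*5≡n*4 = begin
    n * 5                           ≡⟨ sym (∑Region-onSection 3 3 n black) ⟩
    ∑Region 3 3 n (onSection black) ≡⟨ ∑Region-tiling-invariant T (onSection black) (onSection white)
                                         (λ p → brick-balanced n (brick p) (shape p) (inside p)) ⟩
    ∑Region 3 3 n (onSection white) ≡⟨ ∑Region-onSection 3 3 n white ⟩
    n * 4                           ∎
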